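{- For any finite simple graph $G$ with chromatic number $\chi(G)$, we have $\mathrm{lw}_{\chi(G)}(G)\leq \chi(G)$.
   Context: All graphs are finite, undirected and simple. For vertices $u,v$ of a connected graph, $I(u,v)$ is the set of vertices lying on some shortest $(u,v)$-path. A connected graph $M$ is a median graph if for any three vertices $u,v,w$ we have $|I(u,v)\cap I(v,w)\cap I(w,u)|=1$. A set $S\subseteq V(M)$ is convex if $I(u,v)\subseteq S$ for all $u,v\in S$. A median decomposition of a graph $G$ is a pair $(M,(X_a)_{a\in V(M)})$ where $M$ is a median graph and each $X_a\subseteq V(G)$, such that (M1) for every edge $uv$ of $G$ there is $a\in V(M)$ with $u,v\in X_a$, and (M2) for every $v\in V(G)$ the set $\{a\in V(M)\mid v\in X_a\}$ is non-empty and convex in $M$. Its width is $\max\{|X_a|\mid a\in V(M)\}$. A $k$-lattice is a Cartesian product of $k$ paths. A graph $H$ isometrically embeds into $G$ if there is $\phi:V(H)\to V(G)$ with $d_G(\phi(u),\phi(v))=d_H(u,v)$ for all $u,v$. The lattice dimension of a median graph $M$ is the minimum $k$ such that $M$ isometrically embeds into a $k$-lattice. For $i\geq 1$, an $i$-lattice decomposition of $G$ is a median decomposition $(M,\mathcal X)$ where $M$ has lattice dimension at most $i$, and the $i$-latticewidth $\mathrm{lw}_i(G)$ is the minimum width of an $i$-lattice decomposition of $G$. -}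

module Defs where

open import Data.Nat using (ℕ; zero; suc; _+_; _≤_)
open import Data.Fin using (Fin; toℕ)
open import Data.Fin.Subset using (Subset; _∈_; ∣_∣)
open import Data.Product using (Σ; _×_; ∃; ∃-syntax)
open import Relation.Binary.PropositionalEquality using (_≡_; _≢_)
open import Relation.Nullary using (¬_)
open import Level using (Level; _⊔_) renaming (suc to lsuc)

record Graph (n : ℕ) : Set₁ where
  field
    Adj    : Fin n → Fin n → Set
    sym    : ∀ {u v} → Adj u v → Adj v u
    irrefl : ∀ {u} → ¬ Adj u u
open Graph public

data Walk {V : Set} (A : V → V → Set) : V → V → ℕ → Set where
  nil  : ∀ {u} → Walk A u u 0
  cons : ∀ {u w v k} → A u w → Walk A w v k → Walk A u v (suc k)

Dist : {V : Set} (A : V → V → Set) → V → V → ℕ → Set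
Dist A u v d = Walk A u v d × (∀ k → Walk A u v k → d ≤ k)

Connected : {V : Set} (A : V → V → Set) → Set
Connected A = ∀ u v → ∃[ k ] Walk A u v k

InInterval : {V : Set} (A : V → V → Set) → V → V → V → Set
InInterval A u v w =
  Σ ℕ λ d → Dist A u v d × Σ ℕ λ a → Σ ℕ λ b →
    Walk A u w a × Walk A w v b × (a + b ≡ d)

InAllThree : ∀ {m} → Graph m → Fin m → Fin m → Fin m → Fin m → Set
InAllThree M u v w x =
  InInterval (Adj M) u v x × InInterval (Adj M) v w x × InInterval (Adj M) w u x

IsMedian : ∀ {m} → Graph m → Set
IsMedian M = Connected (Adj M) ×
  (∀ u v w → Σ (Fin _) λ x → InAllThree M u v w x ×
              (∀ y → InAllThree M u v w y → y ≡ x))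

Convex : ∀ {m} → Graph m → (Fin m → Set) → Set
Convex M S = ∀ u v w → S u → S v → InInterval (Adj M) u v w → S w

-- k-lattices: Cartesian product of k paths; the i-th path has
-- suc (ℓ i) vertices 0,1,…,ℓ i.

LatticeV : (k : ℕ) → (Fin k → ℕ) → Set
LatticeV k ℓ = (i : Fin k) → Fin (suc (ℓ i))

PathAdj : ∀ {p} → Fin p → Fin p → Set
PathAdj x y = (suc (toℕ x) ≡ toℕ y) Data.Sum.⊎ (suc (toℕ y) ≡ toℕ x)
  where import Data.Sum

LatticeAdj : (k : ℕ) (ℓ : Fin k → ℕ) → LatticeV k ℓ → LatticeV k ℓ → Set
LatticeAdj k ℓ x y = Σ (Fin k) λ i → PathAdj (x i) (y i) × (∀ j → j ≢ i → x j ≡ y j)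

IsometricEmbedding : ∀ {m} (M : Graph m) (k : ℕ) (ℓ : Fin k → ℕ) →
                     (Fin m → LatticeV k ℓ) → Set
IsometricEmbedding M k ℓ φ =
  ∀ u v d → Dist (Adj M) u v d → Dist (LatticeAdj k ℓ) (φ u) (φ v) d

LatticeDimAtMost : ∀ {m} → Graph m → ℕ → Set
LatticeDimAtMost {m} M i =
  Σ ℕ λ k → k ≤ i × Σ (Fin k → ℕ) λ ℓ →
    Σ (Fin m → LatticeV k ℓ) λ φ → IsometricEmbedding M k ℓ φ

record MedianDecomposition {n : ℕ} (G : Graph n) : Set₁ where
  field
    m      : ℕ
    M      : Graph m
    median : IsMedian M
    X      : Fin m → Subset n
    M1     : ∀ u v → Adj G u v → Σ (Fin m) λ a → u ∈ X a × v ∈ X a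
    M2-ne  : ∀ v → Σ (Fin m) λ a → v ∈ X a
    M2-cvx : ∀ v → Convex M (λ a → v ∈ X a)
open MedianDecomposition public

WidthAtMost : ∀ {n} {G : Graph n} → MedianDecomposition G → ℕ → Set
WidthAtMost D w = ∀ a → ∣ X D a ∣ ≤ w

-- lw_i(G) ≤ w : some i-lattice decomposition has width ≤ w
-- (the minimum is ≤ w iff some decomposition attains width ≤ w).
LwAtMost : ∀ {n} → Graph n → ℕ → ℕ → Set₁
LwAtMost G i w = Σ (MedianDecomposition G) λ D →
  LatticeDimAtMost (M D) i × WidthAtMost D w

ProperColouring : ∀ {n} → Graph n → (k : ℕ) → (Fin n → Fin k) → Set
ProperColouring G k c = ∀ u v → Adj G u v → c u ≢ c v

Colourable : ∀ {n} → Graph n → ℕ → Set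
Colourable {n} G k = Σ (Fin n → Fin k) λ c → ProperColouring G k c

IsChromaticNumber : ∀ {n} → Graph n → ℕ → Set
IsChromaticNumber G χ = Colourable G χ × (∀ k → Colourable G k → χ ≤ k)

-- Properly colour G with χ colours c and let M be the grid {0, …, n}^χ, a product of χ paths and
-- hence a median graph of lattice dimension at most χ. Read a grid point a as choosing, for each
-- colour j, at most one vertex of colour j (a_j = v, or a_j = n for none), and let X_a be the set of
-- chosen vertices, i.e. those v with a_{c(v)} = v. A bag holds at most one vertex per colour, so at
-- most χ vertices; the ends of an edge have distinct colours, so some point chooses both; and since
-- intervals in a grid are coordinatewise (w ∈ I(u,v) iff each w_i lies between u_i and v_i), the
-- points whose bag contains v form the convex slab a_{c(v)} = v.

module Submission where

open import Defs hiding (sym)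

open import Algebra.Properties.CommutativeMonoid.Sum as Sum using ()
open import Data.Bool using (true)
open import Data.Empty using (⊥; ⊥-elim)
open import Data.Fin using (Fin; zero; suc; toℕ; inject₁; fromℕ<; punchIn; punchOut; combine; finToFun; funToFin)
open import Data.Fin.Properties
  using (toℕ-injective; toℕ<n; toℕ-fromℕ<; inject₁-injective; punchInᵢ≢i; punchOut-injective; ¬∀⟶∃¬;
         finToFun-funToFin; funToFin-finToFin)
import Data.Fin.Properties as Fin
open import Data.Fin.Subset using (Subset; _∈_; ∣_∣; inside; outside)
open import Data.Nat using (ℕ; zero; suc; _+_; _^_; _≤_; _<_; z≤n; s≤s; ∣_-_∣)
open import Data.Nat.Properties
open import Data.Nat.Tactic.RingSolver using (solve-∀)
open import Data.Product using (Σ; _×_; _,_; proj₁; proj₂)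
open import Data.Sum using (_⊎_; inj₁; inj₂; swap)
open import Data.Vec using (_∷_; []; here; there; tabulate)
open import Data.Vec.Properties using (lookup∘tabulate; []=⇒lookup; lookup⇒[]=)
open import Data.Vec.Functional using (Vector; removeAt; updateAt)
open import Data.Vec.Functional.Properties using (updateAt-updates; updateAt-minimal)
open import Function using (_∘_; id)
open import Relation.Binary.Definitions using (tri<; tri≈; tri>)
open import Relation.Binary.PropositionalEquality
open import Relation.Nullary using (¬_; Dec; yes; no; does; proof)
open import Relation.Nullary.Decidable using (dec-true)
open import Relation.Nullary.Reflects using (Reflects; invert)
open import Relation.Unary using (Decidable)

open Sum +-0-commutativeMonoid using (sum; sum-remove; sum-cong-≗; ∑-distrib-+; sum-replicate-zero)

Between : ℕ → ℕ → ℕ → Set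
Between a x b = (a ≤ x × x ≤ b) ⊎ (b ≤ x × x ≤ a)

between-self⇒≡ : ∀ {a x} → Between a x a → x ≡ a
between-self⇒≡ (inj₁ (a≤x , x≤a)) = ≤-antisym x≤a a≤x
between-self⇒≡ (inj₂ (a≤x , x≤a)) = ≤-antisym x≤a a≤x

between-not-both-below : ∀ {a x b} → Between a x b → a < x → b < x → ⊥
between-not-both-below (inj₁ (_ , x≤b)) _   b<x = <⇒≱ b<x x≤b
between-not-both-below (inj₂ (_ , x≤a)) a<x _   = <⇒≱ a<x x≤a

between-not-both-above : ∀ {a x b} → Between a x b → x < a → x < b → ⊥
between-not-both-above (inj₁ (a≤x , _)) x<a _   = <⇒≱ x<a a≤x
between-not-both-above (inj₂ (b≤x , _)) _   x<b = <⇒≱ x<b b≤x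

∣-∣-additive⇒between : ∀ a x b → ∣ a - x ∣ + ∣ x - b ∣ ≡ ∣ a - b ∣ → Between a x b
∣-∣-additive⇒between zero    x       b       eq = inj₁ (z≤n , subst (x ≤_) eq (m≤m+n x _))
∣-∣-additive⇒between (suc a) zero    zero    eq = inj₂ (z≤n , z≤n)
∣-∣-additive⇒between (suc a) zero    (suc b) eq = ⊥-elim (<⇒≢ ∣a-b∣<a+b (sym eq))
  where
  ∣a-b∣<a+b : ∣ a - b ∣ < suc a + suc b
  ∣a-b∣<a+b = s≤s (≤-trans (∣m-n∣≤m⊔n a b) (≤-trans (m⊔n≤m+n a b) (+-monoʳ-≤ a (n≤1+n b))))
∣-∣-additive⇒between (suc a) (suc x) zero    eq = inj₂ (z≤n , subst (suc x ≤_) eq (m≤n+m (suc x) _))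
∣-∣-additive⇒between (suc a) (suc x) (suc b) eq with ∣-∣-additive⇒between a x b eq
... | inj₁ (a≤x , x≤b) = inj₁ (s≤s a≤x , s≤s x≤b)
... | inj₂ (b≤x , x≤a) = inj₂ (s≤s b≤x , s≤s x≤a)

≤-≤⇒∣-∣-additive : ∀ {a x b} → a ≤ x → x ≤ b → ∣ a - x ∣ + ∣ x - b ∣ ≡ ∣ a - b ∣
≤-≤⇒∣-∣-additive {zero}  {x}     {b}     z≤n       x≤b       =
  trans (cong (x +_) (m≤n⇒∣m-n∣≡n∸m x≤b)) (m+[n∸m]≡n x≤b)
≤-≤⇒∣-∣-additive {suc a} {suc x} {suc b} (s≤s a≤x) (s≤s x≤b) = ≤-≤⇒∣-∣-additive a≤x x≤b

between⇒∣-∣-additive : ∀ {a x b} → Between a x b → ∣ a - x ∣ + ∣ x - b ∣ ≡ ∣ a - b ∣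
between⇒∣-∣-additive (inj₁ (a≤x , x≤b)) = ≤-≤⇒∣-∣-additive a≤x x≤b
between⇒∣-∣-additive {a} {x} {b} (inj₂ (b≤x , x≤a)) = begin
  ∣ a - x ∣ + ∣ x - b ∣ ≡⟨ cong₂ _+_ (∣-∣-comm a x) (∣-∣-comm x b) ⟩
  ∣ x - a ∣ + ∣ b - x ∣ ≡⟨ +-comm ∣ x - a ∣ ∣ b - x ∣ ⟩
  ∣ b - x ∣ + ∣ x - a ∣ ≡⟨ ≤-≤⇒∣-∣-additive b≤x x≤a ⟩
  ∣ b - a ∣             ≡⟨ ∣-∣-comm b a ⟩
  ∣ a - b ∣             ∎
  where open ≡-Reasoning

MedianOf : ℕ → ℕ → ℕ → ℕ → Set
MedianOf a b c x = Between a x b × Between b x c × Between c x a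

median-≤ : ∀ {a b c x y} → MedianOf a b c x → MedianOf a b c y → x ≤ y
median-≤ {a} {b} {c} {x} {y} (xab , xbc , xca) (yab , ybc , yca) with x ≤? y
... | yes x≤y = x≤y
... | no  x≰y = ⊥-elim (split (a <? x) (b <? x) (c <? x))
  where
  -- With y < x, each of a, b, c lies below x or above y, and two of them land on the same side.
  above : ∀ {t} → ¬ t < x → y < t
  above t≮x = <-≤-trans (≰⇒> x≰y) (≮⇒≥ t≮x)
  split : Dec (a < x) → Dec (b < x) → Dec (c < x) → ⊥
  split (yes a<x) (yes b<x) _         = between-not-both-below xab a<x b<x
  split (yes a<x) (no  _  ) (yes c<x) = between-not-both-below xca c<x a<x
  split (yes _  ) (no  b≮x) (no  c≮x) = between-not-both-above ybc (above b≮x) (above c≮x)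
  split (no  _  ) (yes b<x) (yes c<x) = between-not-both-below xbc b<x c<x
  split (no  a≮x) (yes _  ) (no  c≮x) = between-not-both-above yca (above c≮x) (above a≮x)
  split (no  a≮x) (no  b≮x) _         = between-not-both-above yab (above a≮x) (above b≮x)

median-unique : ∀ {a b c x y} → MedianOf a b c x → MedianOf a b c y → x ≡ y
median-unique x-med y-med = ≤-antisym (median-≤ x-med y-med) (median-≤ y-med x-med)

∃-median-by : ∀ {A : Set} (key : A → ℕ) (a b c : A) →
              Σ A λ x → MedianOf (key a) (key b) (key c) (key x)
∃-median-by key a b c with ≤-total (key a) (key b) | ≤-total (key b) (key c) | ≤-total (key a) (key c)
... | inj₁ a≤b | inj₁ b≤c | _        = b , inj₁ (a≤b , ≤-refl) , inj₁ (≤-refl , b≤c) , inj₂ (a≤b , b≤c)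
... | inj₁ a≤b | inj₂ c≤b | inj₁ a≤c = c , inj₁ (a≤c , c≤b) , inj₂ (≤-refl , c≤b) , inj₂ (a≤c , ≤-refl)
... | inj₁ a≤b | inj₂ c≤b | inj₂ c≤a = a , inj₁ (≤-refl , a≤b) , inj₂ (c≤a , a≤b) , inj₁ (c≤a , ≤-refl)
... | inj₂ b≤a | _        | inj₁ a≤c = a , inj₂ (b≤a , ≤-refl) , inj₁ (b≤a , a≤c) , inj₂ (≤-refl , a≤c)
... | inj₂ b≤a | inj₁ b≤c | inj₂ c≤a = c , inj₂ (b≤c , c≤a) , inj₁ (b≤c , ≤-refl) , inj₁ (≤-refl , c≤a)
... | inj₂ b≤a | inj₂ c≤b | inj₂ c≤a = b , inj₂ (≤-refl , b≤a) , inj₂ (c≤b , ≤-refl) , inj₁ (c≤b , b≤a)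

between-< : ∀ {a x b n} → Between a x b → a < n → b < n → x < n
between-< (inj₁ (_ , x≤b)) _   b<n = ≤-<-trans x≤b b<n
between-< (inj₂ (_ , x≤a)) a<n _   = ≤-<-trans x≤a a<n

∣m-1+n∣≡1+∣m-n∣ : ∀ {m n} → m ≤ n → ∣ m - suc n ∣ ≡ suc ∣ m - n ∣
∣m-1+n∣≡1+∣m-n∣ {zero}  z≤n       = refl
∣m-1+n∣≡1+∣m-n∣ {suc m} (s≤s m≤n) = ∣m-1+n∣≡1+∣m-n∣ m≤n

NatAdj : ℕ → ℕ → Set
NatAdj a c = suc a ≡ c ⊎ suc c ≡ a

NatAdj⇒∣-∣≡1 : ∀ {a c} → NatAdj a c → ∣ a - c ∣ ≡ 1
NatAdj⇒∣-∣≡1 {a} (inj₁ refl) = trans (cong (λ t → ∣ a - t ∣) (+-comm 1 a)) (∣m-m+n∣≡n a 1)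
NatAdj⇒∣-∣≡1 {_} {c} (inj₂ refl) = trans (∣-∣-comm (suc c) c) (NatAdj⇒∣-∣≡1 {c} (inj₁ refl))

step-toward : ∀ a b → a ≢ b → Σ ℕ λ c → NatAdj a c × Between a c b × ∣ a - b ∣ ≡ suc ∣ c - b ∣
step-toward a b a≢b with <-cmp a b
... | tri≈ _ a≡b _ = ⊥-elim (a≢b a≡b)
step-toward a (suc b) _ | tri< (s≤s a≤b) _ _ =
  suc a , inj₁ refl , inj₁ (n≤1+n a , s≤s a≤b) , ∣m-1+n∣≡1+∣m-n∣ a≤b
step-toward (suc a) b _ | tri> _ _ (s≤s b≤a) = a , inj₂ refl , inj₂ (b≤a , n≤1+n a) , ∣1+a-b∣≡1+∣a-b∣
  where
  open ≡-Reasoning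
  ∣1+a-b∣≡1+∣a-b∣ : ∣ suc a - b ∣ ≡ suc ∣ a - b ∣
  ∣1+a-b∣≡1+∣a-b∣ = begin
    ∣ suc a - b ∣ ≡⟨ ∣-∣-comm (suc a) b ⟩
    ∣ b - suc a ∣ ≡⟨ ∣m-1+n∣≡1+∣m-n∣ b≤a ⟩
    suc ∣ b - a ∣ ≡⟨ cong suc (∣-∣-comm b a) ⟩
    suc ∣ a - b ∣ ∎

path-step-toward : ∀ {n} (p q : Fin n) → p ≢ q →
                   Σ (Fin n) λ r → PathAdj p r × ∣ toℕ p - toℕ q ∣ ≡ suc ∣ toℕ r - toℕ q ∣
path-step-toward {n} p q p≢q with step-toward (toℕ p) (toℕ q) (p≢q ∘ toℕ-injective)
... | c , p∼c , p-c-q , ∣p-q∣≡1+∣c-q∣ = r , subst (NatAdj (toℕ p)) (sym r≡c) p∼c ,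
      trans ∣p-q∣≡1+∣c-q∣ (cong (λ t → suc ∣ t - toℕ q ∣) (sym r≡c))
  where
  c<n : c < n
  c<n = between-< p-c-q (toℕ<n p) (toℕ<n q)
  r : Fin n
  r = fromℕ< c<n
  r≡c : toℕ r ≡ c
  r≡c = toℕ-fromℕ< c<n

sum-mono-≤ : ∀ {k} {f g : Vector ℕ k} → (∀ i → f i ≤ g i) → sum f ≤ sum g
sum-mono-≤ {zero}  f≤g = z≤n
sum-mono-≤ {suc k} f≤g = +-mono-≤ (f≤g zero) (sum-mono-≤ (f≤g ∘ suc))

sum-mono-≤-tight : ∀ {k} {f g : Vector ℕ k} → (∀ i → f i ≤ g i) → sum g ≤ sum f → ∀ i → f i ≡ g i
sum-mono-≤-tight {suc k} {f} {g} f≤g ∑g≤∑f = tight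
  where
  ∑f′≤∑g′ : sum (f ∘ suc) ≤ sum (g ∘ suc)
  ∑f′≤∑g′ = sum-mono-≤ (f≤g ∘ suc)
  g₀≤f₀ : g zero ≤ f zero
  g₀≤f₀ = +-cancelʳ-≤ _ _ _ (≤-trans ∑g≤∑f (+-monoʳ-≤ (f zero) ∑f′≤∑g′))
  ∑g′≤∑f′ : sum (g ∘ suc) ≤ sum (f ∘ suc)
  ∑g′≤∑f′ = +-cancelˡ-≤ (g zero) _ _ (≤-trans ∑g≤∑f (+-monoˡ-≤ _ (f≤g zero)))
  tight : ∀ i → f i ≡ g i
  tight zero    = ≤-antisym (f≤g zero) g₀≤f₀
  tight (suc i) = sum-mono-≤-tight (f≤g ∘ suc) ∑g′≤∑f′ i

sum≡0⇒≡0 : ∀ {k} {f : Vector ℕ k} → sum f ≡ 0 → ∀ i → f i ≡ 0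
sum≡0⇒≡0 {k} {f} ∑f≡0 i = sym (sum-mono-≤-tight (λ _ → z≤n) ∑f≤∑0 i)
  where
  ∑f≤∑0 : sum f ≤ sum {k} (λ _ → 0)
  ∑f≤∑0 = ≤-reflexive (trans ∑f≡0 (sym (sum-replicate-zero k)))

sum-except : ∀ {k} {f g : Vector ℕ k} (i : Fin k) → (∀ j → j ≢ i → f j ≡ g j) →
             sum f + g i ≡ sum g + f i
sum-except {suc k} {f} {g} i f≡g = begin
  sum f + g i                             ≡⟨ cong (_+ g i) (sum-remove f) ⟩
  f i + sum (removeAt f i) + g i          ≡⟨ cong (λ s → f i + s + g i) (sum-cong-≗ f≡g-off-i) ⟩
  f i + sum (removeAt g i) + g i          ≡⟨ swap-outer (f i) _ (g i) ⟩
  g i + sum (removeAt g i) + f i          ≡⟨ cong (_+ f i) (sum-remove g) ⟨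
  sum g + f i                             ∎
  where
  open ≡-Reasoning
  f≡g-off-i : removeAt f i ≗ removeAt g i
  f≡g-off-i j = f≡g (punchIn i j) (punchInᵢ≢i i j)
  swap-outer : ∀ a s b → a + s + b ≡ b + s + a
  swap-outer = solve-∀

Walk-map : ∀ {V W : Set} {A : V → V → Set} {B : W → W → Set} (f : V → W) →
           (∀ {u v} → A u v → B (f u) (f v)) → ∀ {u v j} → Walk A u v j → Walk B (f u) (f v) j
Walk-map f f-hom nil        = nil
Walk-map f f-hom (cons e W) = cons (f-hom e) (Walk-map f f-hom W)

Dist-unique : ∀ {V : Set} {A : V → V → Set} {u v d d′} → Dist A u v d → Dist A u v d′ → d ≡ d′
Dist-unique (W , d-min) (W′ , d′-min) = ≤-antisym (d-min _ W′) (d′-min _ W)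

funToFin-cong : ∀ {m n} {f g : Fin m → Fin n} → f ≗ g → funToFin f ≡ funToFin g
funToFin-cong {zero}  f≗g = refl
funToFin-cong {suc m} f≗g = cong₂ combine (f≗g zero) (funToFin-cong (f≗g ∘ suc))

finToFun-injective : ∀ {m n} {a b : Fin (m ^ n)} → finToFun {m} {n} a ≗ finToFun b → a ≡ b
finToFun-injective {m} {n} {a} {b} a≗b = begin
  a                                ≡⟨ funToFin-finToFin {n} {m} a ⟨
  funToFin {n} (finToFun {m} a)    ≡⟨ funToFin-cong a≗b ⟩
  funToFin {n} (finToFun {m} b)    ≡⟨ funToFin-finToFin {n} {m} b ⟩
  b                                ∎
  where open ≡-Reasoning

module Lattice (k N : ℕ) where

  Point : Set
  Point = LatticeV k (λ _ → N)

  _∼_ : Point → Point → Set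
  _∼_ = LatticeAdj k (λ _ → N)

  ∼-sym : ∀ {x y} → x ∼ y → y ∼ x
  ∼-sym (i , xᵢ∼yᵢ , x≡y-off-i) = i , swap xᵢ∼yᵢ , λ j j≢i → sym (x≡y-off-i j j≢i)

  ∼-irrefl : ∀ {x} → ¬ x ∼ x
  ∼-irrefl (_ , inj₁ 1+n≡n , _) = 1+n≢n 1+n≡n
  ∼-irrefl (_ , inj₂ 1+n≡n , _) = 1+n≢n 1+n≡n

  ∼-respʳ-≗ : ∀ {x y y′} → x ∼ y → y ≗ y′ → x ∼ y′
  ∼-respʳ-≗ {x} (i , xᵢ∼yᵢ , x≡y-off-i) y≗y′ =
    i , subst (PathAdj (x i)) (y≗y′ i) xᵢ∼yᵢ , λ j j≢i → trans (x≡y-off-i j j≢i) (y≗y′ j)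

  ℓ₁ : Point → Point → ℕ
  ℓ₁ x y = sum λ i → ∣ toℕ (x i) - toℕ (y i) ∣

  ℓ₁-cong : ∀ {x x′ y y′} → x ≗ x′ → y ≗ y′ → ℓ₁ x y ≡ ℓ₁ x′ y′
  ℓ₁-cong x≗x′ y≗y′ = sum-cong-≗ λ i → cong₂ (λ s t → ∣ toℕ s - toℕ t ∣) (x≗x′ i) (y≗y′ i)

  ≗⇒ℓ₁≡0 : ∀ {x y} → x ≗ y → ℓ₁ x y ≡ 0
  ≗⇒ℓ₁≡0 x≗y = trans (sum-cong-≗ λ i → m≡n⇒∣m-n∣≡0 (cong toℕ (x≗y i))) (sum-replicate-zero k)

  ℓ₁≡0⇒≗ : ∀ {x y} → ℓ₁ x y ≡ 0 → x ≗ y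
  ℓ₁≡0⇒≗ ℓ₁≡0 i = toℕ-injective (∣m-n∣≡0⇒m≡n (sum≡0⇒≡0 ℓ₁≡0 i))

  ℓ₁-triangle : ∀ x y z → ℓ₁ x z ≤ ℓ₁ x y + ℓ₁ y z
  ℓ₁-triangle x y z = ≤-trans
    (sum-mono-≤ λ i → ∣-∣-triangle (toℕ (x i)) (toℕ (y i)) (toℕ (z i)))
    (≤-reflexive (∑-distrib-+ (λ i → ∣ toℕ (x i) - toℕ (y i) ∣) _))

  ∼⇒ℓ₁≡1 : ∀ {x y} → x ∼ y → ℓ₁ x y ≡ 1
  ∼⇒ℓ₁≡1 {x} {y} (i , xᵢ∼yᵢ , x≡y-off-i) = +-cancelʳ-≡ 0 _ _ (begin
    ℓ₁ x y + 0                                     ≡⟨ sum-except i ∣x-y∣≡0-off-i ⟩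
    sum {k} (λ _ → 0) + ∣ toℕ (x i) - toℕ (y i) ∣  ≡⟨ cong₂ _+_ (sum-replicate-zero k) (NatAdj⇒∣-∣≡1 xᵢ∼yᵢ) ⟩
    1                                              ∎)
    where
    open ≡-Reasoning
    ∣x-y∣≡0-off-i : ∀ j → j ≢ i → ∣ toℕ (x j) - toℕ (y j) ∣ ≡ 0
    ∣x-y∣≡0-off-i j j≢i = m≡n⇒∣m-n∣≡0 (cong toℕ (x≡y-off-i j j≢i))

  ℓ₁≤length : ∀ {x y j} → Walk _∼_ x y j → ℓ₁ x y ≤ j
  ℓ₁≤length {x} nil = ≤-reflexive (≗⇒ℓ₁≡0 {x} λ _ → refl)
  ℓ₁≤length {x} {y} (cons {w = w} {k = j} x∼w W) = begin
    ℓ₁ x y            ≤⟨ ℓ₁-triangle x w y ⟩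
    ℓ₁ x w + ℓ₁ w y   ≡⟨ cong (_+ ℓ₁ w y) (∼⇒ℓ₁≡1 x∼w) ⟩
    suc (ℓ₁ w y)      ≤⟨ s≤s (ℓ₁≤length W) ⟩
    suc j             ∎
    where open ≤-Reasoning

  ℓ₁-step-toward : ∀ {x y d} → ℓ₁ x y ≡ suc d → Σ Point λ x′ → x ∼ x′ × ℓ₁ x′ y ≡ d
  ℓ₁-step-toward {x} {y} {d} ℓ₁≡1+d
    with ¬∀⟶∃¬ k _ (λ i → x i Fin.≟ y i) (λ x≗y → 0≢1+n (trans (sym (≗⇒ℓ₁≡0 x≗y)) ℓ₁≡1+d))
  ... | i , xᵢ≢yᵢ with path-step-toward (x i) (y i) xᵢ≢yᵢ
  ... | r , xᵢ∼r , fᵢ≡1+∣r-yᵢ∣ = x′ , x∼x′ , suc-injective (+-cancelʳ-≡ (g i) _ _ (begin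
    suc (ℓ₁ x′ y) + g i  ≡⟨ +-suc (ℓ₁ x′ y) (g i) ⟨
    ℓ₁ x′ y + suc (g i)  ≡⟨ cong (ℓ₁ x′ y +_) fᵢ≡1+gᵢ ⟨
    ℓ₁ x′ y + f i        ≡⟨ sum-except i f≡g-off-i ⟨
    ℓ₁ x y + g i         ≡⟨ cong (_+ g i) ℓ₁≡1+d ⟩
    suc d + g i          ∎))
    where
    open ≡-Reasoning
    x′ : Point
    x′ = updateAt x i λ _ → r
    x′ᵢ≡r : x′ i ≡ r
    x′ᵢ≡r = updateAt-updates i x
    x≡x′-off-i : ∀ j → j ≢ i → x j ≡ x′ j
    x≡x′-off-i j j≢i = sym (updateAt-minimal j i x j≢i)
    x∼x′ : x ∼ x′
    x∼x′ = i , subst (PathAdj (x i)) (sym x′ᵢ≡r) xᵢ∼r , x≡x′-off-i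
    f g : Vector ℕ k
    f j = ∣ toℕ (x j) - toℕ (y j) ∣
    g j = ∣ toℕ (x′ j) - toℕ (y j) ∣
    f≡g-off-i : ∀ j → j ≢ i → f j ≡ g j
    f≡g-off-i j j≢i = cong (λ t → ∣ toℕ t - toℕ (y j) ∣) (x≡x′-off-i j j≢i)
    fᵢ≡1+gᵢ : f i ≡ suc (g i)
    fᵢ≡1+gᵢ = trans fᵢ≡1+∣r-yᵢ∣ (cong (λ t → suc ∣ toℕ t - toℕ (y i) ∣) (sym x′ᵢ≡r))

-- A median decomposition needs a graph on some Fin m, so the points of the lattice are encoded
-- as Fin ((1 + N) ^ k) through finToFun.
module GridGraph (k N : ℕ) where

  open Lattice k N public

  Vertex : Set
  Vertex = Fin (suc N ^ k)

  coords : Vertex → Point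
  coords = finToFun

  co : Vertex → Fin k → ℕ
  co a i = toℕ (coords a i)

  Grid : Graph (suc N ^ k)
  Grid = record { Adj = λ a b → coords a ∼ coords b ; sym = ∼-sym ; irrefl = ∼-irrefl }

  grid-walk : ∀ {a b} d → ℓ₁ (coords a) (coords b) ≡ d → Walk (Adj Grid) a b d
  grid-walk {a} zero ℓ₁≡0 =
    subst (λ b → Walk (Adj Grid) a b 0) (finToFun-injective {suc N} {k} (ℓ₁≡0⇒≗ ℓ₁≡0)) nil
  grid-walk {a} {b} (suc d) ℓ₁≡1+d = walk-via (ℓ₁-step-toward ℓ₁≡1+d)
    where
    walk-via : Σ Point (λ x′ → coords a ∼ x′ × ℓ₁ x′ (coords b) ≡ d) → Walk (Adj Grid) a b (suc d)
    walk-via (x′ , a∼x′ , ℓ₁≡d) =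
      cons (∼-respʳ-≗ a∼x′ (sym ∘ coords-x′)) (grid-walk d (trans (ℓ₁-cong coords-x′ (λ _ → refl)) ℓ₁≡d))
      where
      coords-x′ : coords (funToFin x′) ≗ x′
      coords-x′ = finToFun-funToFin x′

  grid-dist : ∀ a b → Dist (Adj Grid) a b (ℓ₁ (coords a) (coords b))
  grid-dist a b = grid-walk _ refl , λ j W → ℓ₁≤length (Walk-map coords id W)

  coords-isometric : IsometricEmbedding Grid k (λ _ → N) coords
  coords-isometric a b d dist@(W , _) = Walk-map coords id W , λ j W′ →
    subst (_≤ j) (Dist-unique (grid-dist a b) dist) (ℓ₁≤length W′)

  grid-interval⇒between : ∀ {u v w} → InInterval (Adj Grid) u v w →
                          ∀ i → Between (co u i) (co w i) (co v i)
  grid-interval⇒between {u} {v} {w} (d , dist , a , b , W₁ , W₂ , a+b≡d) i =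
    ∣-∣-additive⇒between _ _ _ (sym (sum-mono-≤-tight triangle ∑≤ℓ₁ i))
    where
    triangle : ∀ i → ∣ co u i - co v i ∣ ≤ ∣ co u i - co w i ∣ + ∣ co w i - co v i ∣
    triangle i = ∣-∣-triangle (co u i) (co w i) (co v i)
    ∑≤ℓ₁ : sum (λ i → ∣ co u i - co w i ∣ + ∣ co w i - co v i ∣) ≤ ℓ₁ (coords u) (coords v)
    ∑≤ℓ₁ = begin
      sum (λ i → ∣ co u i - co w i ∣ + ∣ co w i - co v i ∣) ≡⟨ ∑-distrib-+ (λ i → ∣ co u i - co w i ∣) _ ⟩
      ℓ₁ (coords u) (coords w) + ℓ₁ (coords w) (coords v)   ≤⟨ +-mono-≤ (proj₂ (grid-dist u w) a W₁)
                                                                        (proj₂ (grid-dist w v) b W₂) ⟩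
      a + b                                                 ≡⟨ a+b≡d ⟩
      d                                                     ≡⟨ Dist-unique dist (grid-dist u v) ⟩
      ℓ₁ (coords u) (coords v)                              ∎
      where open ≤-Reasoning

  between⇒grid-interval : ∀ {u v w} → (∀ i → Between (co u i) (co w i) (co v i)) →
                          InInterval (Adj Grid) u v w
  between⇒grid-interval {u} {v} {w} between =
    _ , grid-dist u v , _ , _ , grid-walk _ refl , grid-walk _ refl ,
    trans (sym (∑-distrib-+ (λ i → ∣ co u i - co w i ∣) _)) (sum-cong-≗ (between⇒∣-∣-additive ∘ between))

  inAllThree⇒median : ∀ {u v w x} → InAllThree Grid u v w x →
                      ∀ i → MedianOf (co u i) (co v i) (co w i) (co x i)
  inAllThree⇒median (x∈uv , x∈vw , x∈wu) i =
    grid-interval⇒between x∈uv i , grid-interval⇒between x∈vw i , grid-interval⇒between x∈wu i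

  median⇒inAllThree : ∀ {u v w x} → (∀ i → MedianOf (co u i) (co v i) (co w i) (co x i)) →
                      InAllThree Grid u v w x
  median⇒inAllThree median =
    between⇒grid-interval (proj₁ ∘ median) ,
    between⇒grid-interval (proj₁ ∘ proj₂ ∘ median) ,
    between⇒grid-interval (proj₂ ∘ proj₂ ∘ median)

  median-vertex : Vertex → Vertex → Vertex → Vertex
  median-vertex u v w = funToFin λ i → proj₁ (∃-median-by toℕ (coords u i) (coords v i) (coords w i))

  median-vertex-median : ∀ u v w i → MedianOf (co u i) (co v i) (co w i) (co (median-vertex u v w) i)
  median-vertex-median u v w i =
    subst (MedianOf (co u i) (co v i) (co w i)) (cong toℕ (sym (finToFun-funToFin _ i)))
      (proj₂ (∃-median-by toℕ (coords u i) (coords v i) (coords w i)))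

  grid-isMedian : IsMedian Grid
  grid-isMedian = (λ a b → _ , grid-walk _ refl) , λ u v w →
    median-vertex u v w , median⇒inAllThree (median-vertex-median u v w) , λ x x-median →
      finToFun-injective {suc N} {k} λ i → toℕ-injective
        (median-unique (inAllThree⇒median x-median i) (median-vertex-median u v w i))

injection⇒∣p∣≤ : ∀ {n k} (p : Subset n) (f : ∀ {v} → v ∈ p → Fin k) →
                 (∀ {u v} (u∈p : u ∈ p) (v∈p : v ∈ p) → f u∈p ≡ f v∈p → u ≡ v) → ∣ p ∣ ≤ k
injection⇒∣p∣≤ []            f f-inj = z≤n
injection⇒∣p∣≤ (outside ∷ p) f f-inj =
  injection⇒∣p∣≤ p (f ∘ there) λ u∈p v∈p eq → Fin.suc-injective (f-inj (there u∈p) (there v∈p) eq)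
injection⇒∣p∣≤ {k = zero}  (inside ∷ p) f f-inj with f here
... | ()
injection⇒∣p∣≤ {k = suc k} (inside ∷ p) f f-inj = s≤s (injection⇒∣p∣≤ p f′ f′-inj)
  where
  f₀≢f : ∀ {v} (v∈p : v ∈ p) → f here ≢ f (there v∈p)
  f₀≢f v∈p eq with f-inj here (there v∈p) eq
  ... | ()
  f′ : ∀ {v} → v ∈ p → Fin k
  f′ v∈p = punchOut (f₀≢f v∈p)
  f′-inj : ∀ {u v} (u∈p : u ∈ p) (v∈p : v ∈ p) → f′ u∈p ≡ f′ v∈p → u ≡ v
  f′-inj u∈p v∈p eq =
    Fin.suc-injective (f-inj (there u∈p) (there v∈p) (punchOut-injective (f₀≢f u∈p) (f₀≢f v∈p) eq))

subsetOf : ∀ {n} {P : Fin n → Set} → Decidable P → Subset n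
subsetOf P? = tabulate (does ∘ P?)

∈-subsetOf⁺ : ∀ {n} {P : Fin n → Set} (P? : Decidable P) {v} → P v → v ∈ subsetOf P?
∈-subsetOf⁺ P? {v} Pv = lookup⇒[]= v _ (trans (lookup∘tabulate (does ∘ P?) v) (dec-true (P? v) Pv))

∈-subsetOf⁻ : ∀ {n} {P : Fin n → Set} (P? : Decidable P) {v} → v ∈ subsetOf P? → P v
∈-subsetOf⁻ P? {v} v∈ = invert (subst (Reflects _) does≡true (proof (P? v)))
  where
  does≡true : does (P? v) ≡ true
  does≡true = trans (sym (lookup∘tabulate (does ∘ P?) v)) ([]=⇒lookup v∈)

module ColouringDecomposition {n : ℕ} (G : Graph n) (k : ℕ) (c : Fin n → Fin k)
                              (c-proper : ProperColouring G k c) where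

  open GridGraph k n

  _holds_ : Vertex → Fin n → Set
  a holds v = coords a (c v) ≡ inject₁ v

  bag : Vertex → Subset n
  bag a = subsetOf λ v → coords a (c v) Fin.≟ inject₁ v

  ∈-bag⁺ : ∀ {a v} → a holds v → v ∈ bag a
  ∈-bag⁺ {a} = ∈-subsetOf⁺ (λ v → coords a (c v) Fin.≟ inject₁ v)

  ∈-bag⁻ : ∀ {a v} → v ∈ bag a → a holds v
  ∈-bag⁻ {a} = ∈-subsetOf⁻ (λ v → coords a (c v) Fin.≟ inject₁ v)

  bag-width : ∀ a → ∣ bag a ∣ ≤ k
  bag-width a = injection⇒∣p∣≤ (bag a) (λ {v} _ → c v) λ u∈ v∈ cᵤ≡cᵥ →
    inject₁-injective (trans (sym (∈-bag⁻ u∈)) (trans (cong (coords a) cᵤ≡cᵥ) (∈-bag⁻ v∈)))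

  edge-covered : ∀ u v → Adj G u v → Σ Vertex λ a → u ∈ bag a × v ∈ bag a
  edge-covered u v u∼v =
    funToFin x ,
    ∈-bag⁺ (trans (finToFun-funToFin x (c u)) (updateAt-updates (c u) _)) ,
    ∈-bag⁺ (trans (finToFun-funToFin x (c v)) (updateAt-minimal (c v) (c u) _ (c-proper u v u∼v ∘ sym)))
    where
    x : Point
    x = updateAt (λ _ → inject₁ v) (c u) λ _ → inject₁ u

  vertex-covered : ∀ v → Σ Vertex λ a → v ∈ bag a
  vertex-covered v = funToFin x , ∈-bag⁺ (finToFun-funToFin x (c v))
    where
    x : Point
    x _ = inject₁ v

  bags-convex : ∀ v → Convex Grid λ a → v ∈ bag a
  bags-convex v a b w v∈a v∈b w∈ab = ∈-bag⁺ {w} (toℕ-injective (between-self⇒≡ v-wᵥ-v))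
    where
    v-wᵥ-v : Between (toℕ (inject₁ v)) (co w (c v)) (toℕ (inject₁ v))
    v-wᵥ-v = subst₂ (λ s t → Between s (co w (c v)) t) (cong toℕ (∈-bag⁻ v∈a)) (cong toℕ (∈-bag⁻ v∈b))
               (grid-interval⇒between w∈ab (c v))

  decomposition : MedianDecomposition G
  decomposition = record
    { M      = Grid
    ; median = grid-isMedian
    ; X      = bag
    ; M1     = edge-covered
    ; M2-ne  = vertex-covered
    ; M2-cvx = bags-convex
    }

lemma3p3 : ∀ {n : ℕ} (G : Graph n) (χ : ℕ) → IsChromaticNumber G χ → LwAtMost G χ χ
lemma3p3 {n} G χ ((c , c-proper) , _) =
  decomposition , (χ , ≤-refl , (λ _ → n) , coords , coords-isometric) , bag-width
  where
  open ColouringDecomposition G χ c c-proper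
  open GridGraph χ n
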